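{- Let $n = p_1^{k_1} p_2^{k_2} \cdots p_r^{k_r}$ be the prime factorization of a positive integer $n$, with distinct primes $p_i$ and integers $k_i \ge 1$, and let $D = \prod_{i=1}^r (k_i+1)$ be the number of divisors of $n$. Then the hyper-Wiener index of the divisor prime graph $G_{Dp(n)}$ is $$WW(G_{Dp(n)}) = \frac{3D(D-1)}{2} - \prod_{i=1}^r (2k_i+1) + 1.$$
   Context: For a positive integer $n$, the divisor prime graph $G_{Dp(n)}$ is the simple graph whose vertex set is the set of positive divisors of $n$, in which two distinct vertices $x, y$ are adjacent if and only if $\gcd(x,y) = 1$ (no loops). For a connected graph $G$, $d(u,v)$ denotes the shortest-path distance, and the hyper-Wiener index is $WW(G) = \frac{1}{2}\sum_{\{u,v\}} \left(d(u,v) + d(u,v)^2\right)$, the sum over all unordered pairs of distinct vertices. -}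

module Defs where

open import Data.Nat using (ℕ; zero; suc; _+_; _*_; _/_; _≤_)
open import Data.Nat.Divisibility using (_∣_; _∣?_)
open import Data.Nat.GCD using (gcd)
open import Data.List using (List; []; _∷_; map; _++_; filter; applyUpTo)
open import Data.Nat.ListAction using (sum)
open import Data.Product using (_×_; _,_)
open import Relation.Binary.PropositionalEquality using (_≡_; _≢_)

divisors : ℕ → List ℕ
divisors n = filter (λ d → d ∣? n) (applyUpTo suc n)

Adj : ℕ → ℕ → Set
Adj x y = (x ≢ y) × (gcd x y ≡ 1)

data Walk (n : ℕ) : ℕ → ℕ → ℕ → Set where
  here : ∀ {u} → Walk n zero u u
  step : ∀ {k u w v} → w ∣ n → Adj u w → Walk n k w v → Walk n (suc k) u v

IsDist : ℕ → ℕ → ℕ → ℕ → Set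
IsDist n u v k = Walk n k u v × (∀ m → Walk n m u v → k ≤ m)

pairs : {A : Set} → List A → List (A × A)
pairs []       = []
pairs (x ∷ xs) = map (λ y → (x , y)) xs ++ pairs xs

-- Hyper-Wiener index of G_{Dp(n)} given its distance function d:
-- sum over unordered pairs of distinct divisors of (d + d^2)/2
-- (d + d^2 is always even, so the division is exact).
hyperWiener : ℕ → (ℕ → ℕ → ℕ) → ℕ
hyperWiener n d = sum (map (λ { (u , v) → (d u v + d u v * d u v) / 2 }) (pairs (divisors n)))

module Submission where

-- Every divisor is adjacent to 1, so two distinct divisors are at distance 1 when coprime
-- and 2 otherwise; each pair contributes 1 or 3 to WW, i.e. WW + 2 c = 3 D (D - 1) / 2 where c
-- counts the coprime pairs.  Counting instead ordered pairs, diagonal included (only (1, 1) is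
-- coprime there), gives 2 c + 1 coprime ones.  That count is multiplicative, because for
-- coprime a, b the divisors of a b are exactly the products of a divisor of a and one of b,
-- and for p ^ k it is 2 k + 1: the pairs (1, p ^ i) and (p ^ i, 1).

open import Defs
open import Data.Nat
  using (ℕ; zero; suc; _+_; _*_; _∸_; _^_; _/_; _≤_; z≤n; s≤s; NonZero; ≢-nonZero; ≢-nonZero⁻¹; nonTrivial⇒n>1; nonTrivial⇒≢1)
open import Data.Nat.Properties
open import Data.Nat.DivMod using (m*n/n≡m)
open import Data.Nat.Divisibility
open import Data.Nat.GCD using (gcd; gcd[m,n]∣m; gcd[m,n]∣n; gcd[m,n]≢0; gcd-greatest; c*gcd[m,n]≡gcd[cm,cn])
open import Data.Nat.Coprimality using (Coprime; coprime?; coprime-divisor; coprime⇒gcd≡1; gcd≡1⇒coprime; 1-coprimeTo)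
import Data.Nat.Coprimality as Coprime
open import Data.Nat.Primality using (Prime; prime⇒irreducible; prime⇒nonZero; prime⇒nonTrivial)
open import Data.Nat.ListAction using (sum; product)
open import Data.Nat.ListAction.Properties using (sum-++; sum-↭)
open import Data.Nat.Tactic.RingSolver using (solve-∀)
open import Data.List using (List; []; _∷_; map; _++_; length; applyUpTo; cartesianProductWith)
open import Data.List.Properties using (map-++; map-∘; length-++; length-map; length-applyUpTo)
open import Data.List.Membership.Propositional using (_∈_)
open import Data.List.Membership.Propositional.Properties
  using (∈-map⁻; ∈-++⁻; ∈-applyUpTo⁺; ∈-applyUpTo⁻; ∈-filter⁺; ∈-filter⁻
        ; ∈-cartesianProductWith⁺; ∈-cartesianProductWith⁻)
open import Data.List.Membership.Propositional.Properties.WithK using (unique∧set⇒bag)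
open import Data.List.Relation.Binary.BagAndSetEquality using (∼bag⇒↭)
open import Data.List.Relation.Binary.Permutation.Propositional using (_↭_)
open import Data.List.Relation.Binary.Permutation.Propositional.Properties using (↭-length) renaming (map⁺ to ↭-map⁺)
open import Data.List.Relation.Unary.All using (All; []; _∷_; tabulate) renaming (lookup to All-lookup)
open import Data.List.Relation.Unary.All.Properties using () renaming (map⁺ to All-map⁺)
open import Data.List.Relation.Unary.Any using (here; there)
open import Data.List.Relation.Unary.AllPairs using ([]; _∷_)
open import Data.List.Relation.Unary.Unique.Propositional using (Unique)
import Data.List.Relation.Unary.Unique.Propositional.Properties as Unique
open import Data.Product using (_×_; _,_; proj₁; proj₂; ∃; ∃₂; uncurry)
open import Data.Sum using (inj₁; inj₂; [_,_]′)
open import Function using (_∘_; _⇔_; mk⇔; Equivalence)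
open import Relation.Nullary using (¬_; Dec; yes; no; contradiction)
open import Data.Empty using (⊥-elim)
open import Relation.Binary.PropositionalEquality

private
  variable
    A B C P Q R : Set
    n p x : ℕ

∑ : List A → (A → ℕ) → ℕ
∑ xs f = sum (map f xs)

∑-cong : ∀ xs {f g : A → ℕ} → (∀ {x} → x ∈ xs → f x ≡ g x) → ∑ xs f ≡ ∑ xs g
∑-cong []       f≗g = refl
∑-cong (x ∷ xs) f≗g = cong₂ _+_ (f≗g (here refl)) (∑-cong xs (f≗g ∘ there))

∑-++ : ∀ (xs ys : List A) f → ∑ (xs ++ ys) f ≡ ∑ xs f + ∑ ys f
∑-++ xs ys f = trans (cong sum (map-++ f xs ys)) (sum-++ (map f xs) (map f ys))

∑-map : ∀ (h : A → B) xs f → ∑ (map h xs) f ≡ ∑ xs (f ∘ h)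
∑-map h xs f = cong sum (sym (map-∘ xs))

∑-↭ : ∀ {xs ys : List A} f → xs ↭ ys → ∑ xs f ≡ ∑ ys f
∑-↭ f xs↭ys = sum-↭ (↭-map⁺ f xs↭ys)

∑-+ : ∀ (xs : List A) f g → ∑ xs (λ x → f x + g x) ≡ ∑ xs f + ∑ xs g
∑-+ []       f g = refl
∑-+ (x ∷ xs) f g = trans (cong (f x + g x +_) (∑-+ xs f g)) (+-+-comm-assoc (f x) (g x) _ _)
  where
  +-+-comm-assoc : ∀ a b c d → a + b + (c + d) ≡ a + c + (b + d)
  +-+-comm-assoc = solve-∀

∑-const : ∀ (xs : List A) c → ∑ xs (λ _ → c) ≡ length xs * c
∑-const []       c = refl
∑-const (x ∷ xs) c = cong (c +_) (∑-const xs c)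

∑-0≡0 : ∀ (xs : List A) → ∑ xs (λ _ → 0) ≡ 0
∑-0≡0 xs = trans (∑-const xs 0) (*-zeroʳ (length xs))

∑-1≡length : ∀ (xs : List A) → ∑ xs (λ _ → 1) ≡ length xs
∑-1≡length xs = trans (∑-const xs 1) (*-identityʳ (length xs))

*-distribˡ-∑ : ∀ c (xs : List A) f → c * ∑ xs f ≡ ∑ xs (λ x → c * f x)
*-distribˡ-∑ c []       f = *-zeroʳ c
*-distribˡ-∑ c (x ∷ xs) f = trans (*-distribˡ-+ c (f x) _) (cong (c * f x +_) (*-distribˡ-∑ c xs f))

∑-*-∑ : ∀ (xs : List A) (ys : List B) f g → ∑ xs (λ x → ∑ ys (λ y → f x * g y)) ≡ ∑ xs f * ∑ ys g
∑-*-∑ []       ys f g = refl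
∑-*-∑ (x ∷ xs) ys f g = begin
  ∑ ys (λ y → f x * g y) + ∑ xs (λ x → ∑ ys (λ y → f x * g y))
    ≡⟨ cong₂ _+_ (sym (*-distribˡ-∑ (f x) ys g)) (∑-*-∑ xs ys f g) ⟩
  f x * ∑ ys g + ∑ xs f * ∑ ys g
    ≡⟨ sym (*-distribʳ-+ (∑ ys g) (f x) (∑ xs f)) ⟩
  (f x + ∑ xs f) * ∑ ys g ∎
  where open ≡-Reasoning

∑-cartesianProductWith : ∀ (h : A → B → C) xs ys f →
  ∑ (cartesianProductWith h xs ys) f ≡ ∑ xs (λ x → ∑ ys (λ y → f (h x y)))
∑-cartesianProductWith h []       ys f = refl
∑-cartesianProductWith h (x ∷ xs) ys f =
  trans (∑-++ (map (h x) ys) _ f) (cong₂ _+_ (∑-map (h x) ys f) (∑-cartesianProductWith h xs ys f))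

length-cartesianProductWith : ∀ (h : A → B → C) xs ys →
  length (cartesianProductWith h xs ys) ≡ length xs * length ys
length-cartesianProductWith h []       ys = refl
length-cartesianProductWith h (x ∷ xs) ys =
  trans (length-++ (map (h x) ys)) (cong₂ _+_ (length-map (h x) ys) (length-cartesianProductWith h xs ys))

Unique-map⁺ : ∀ (f : A → B) {xs} → (∀ {x y} → x ∈ xs → y ∈ xs → f x ≡ f y → x ≡ y) →
  Unique xs → Unique (map f xs)
Unique-map⁺ f inj []          = []
Unique-map⁺ f inj (x∉xs ∷ xs!) =
  All-map⁺ (tabulate λ y∈xs fx≡fy → All-lookup x∉xs y∈xs (inj (here refl) (there y∈xs) fx≡fy))
  ∷ Unique-map⁺ f (λ x∈ y∈ → inj (there x∈) (there y∈)) xs!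

Unique-cartesianProductWith⁺ : ∀ (h : A → B → C) {xs ys} →
  (∀ {x x′ y y′} → x ∈ xs → x′ ∈ xs → y ∈ ys → y′ ∈ ys → h x y ≡ h x′ y′ → x ≡ x′ × y ≡ y′) →
  Unique xs → Unique ys → Unique (cartesianProductWith h xs ys)
Unique-cartesianProductWith⁺ h inj []           ys! = []
Unique-cartesianProductWith⁺ h {x ∷ xs} {ys} inj (x∉xs ∷ xs!) ys! =
  Unique.++⁺ (Unique-map⁺ (h x) (λ y∈ y′∈ → proj₂ ∘ inj (here refl) (here refl) y∈ y′∈) ys!)
             (Unique-cartesianProductWith⁺ h (λ x∈ x′∈ → inj (there x∈) (there x′∈)) xs! ys!)
             disjoint
  where
  disjoint : ∀ {v} → ¬ (v ∈ map (h x) ys × v ∈ cartesianProductWith h xs ys)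
  disjoint (v∈row , v∈rest) with ∈-map⁻ (h x) v∈row | ∈-cartesianProductWith⁻ h xs ys v∈rest
  ... | y , y∈ , refl | x′ , y′ , x′∈ , y′∈ , eq =
    All-lookup x∉xs x′∈ (proj₁ (inj (here refl) (there x′∈) y∈ y′∈ eq))

∈-pairs⁻ : ∀ {xs : List A} {u v} → Unique xs → (u , v) ∈ pairs xs → u ∈ xs × v ∈ xs × u ≢ v
∈-pairs⁻ {xs = x ∷ xs} (x∉xs ∷ xs!) uv∈ with ∈-++⁻ (map (x ,_) xs) uv∈
... | inj₁ uv∈row with ∈-map⁻ (x ,_) uv∈row
...   | y , y∈ , refl = here refl , there y∈ , All-lookup x∉xs y∈
∈-pairs⁻ {xs = x ∷ xs} (x∉xs ∷ xs!) uv∈ | inj₂ uv∈rest =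
  let u∈ , v∈ , u≢v = ∈-pairs⁻ xs! uv∈rest in there u∈ , there v∈ , u≢v

∑-pairs-∷ : ∀ (x : A) xs f → ∑ (pairs (x ∷ xs)) f ≡ ∑ xs (λ y → f (x , y)) + ∑ (pairs xs) f
∑-pairs-∷ x xs f = trans (∑-++ (map (x ,_) xs) (pairs xs) f) (cong (_+ ∑ (pairs xs) f) (∑-map (x ,_) xs f))

∑-pairs-symmetric : ∀ (h : A → A → ℕ) → (∀ x y → h x y ≡ h y x) → ∀ xs →
  2 * ∑ (pairs xs) (uncurry h) + ∑ xs (λ x → h x x) ≡ ∑ xs (λ x → ∑ xs (h x))
∑-pairs-symmetric h h-sym []       = refl
∑-pairs-symmetric h h-sym (x ∷ xs) = begin
  2 * ∑ (pairs (x ∷ xs)) (uncurry h) + (h x x + diag)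
    ≡⟨ cong (λ t → 2 * t + (h x x + diag)) (∑-pairs-∷ x xs (uncurry h)) ⟩
  2 * (row + offDiag) + (h x x + diag)
    ≡⟨ rearrange (h x x) row offDiag diag ⟩
  (h x x + row) + (row + (2 * offDiag + diag))
    ≡⟨ cong₂ (λ s t → (h x x + row) + (s + t))
             (∑-cong xs λ {y} _ → h-sym x y) (∑-pairs-symmetric h h-sym xs) ⟩
  (h x x + row) + (∑ xs (λ y → h y x) + ∑ xs (λ y → ∑ xs (h y)))
    ≡⟨ cong ((h x x + row) +_) (sym (∑-+ xs (λ y → h y x) (λ y → ∑ xs (h y)))) ⟩
  ∑ (x ∷ xs) (λ y → ∑ (x ∷ xs) (h y)) ∎
  where
  open ≡-Reasoning
  row     = ∑ xs (h x)
  offDiag = ∑ (pairs xs) (uncurry h)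
  diag    = ∑ xs (λ y → h y y)
  rearrange : ∀ d r o t → 2 * (r + o) + (d + t) ≡ (d + r) + (r + (2 * o + t))
  rearrange = solve-∀

length-pairs : ∀ (xs : List A) → 2 * length (pairs xs) + length xs ≡ length xs * length xs
length-pairs xs = begin
  2 * length (pairs xs) + length xs
    ≡⟨ cong₂ (λ s t → 2 * s + t) (sym (∑-1≡length (pairs xs))) (sym (∑-1≡length xs)) ⟩
  2 * ∑ (pairs xs) (λ _ → 1) + ∑ xs (λ _ → 1)
    ≡⟨ ∑-pairs-symmetric (λ _ _ → 1) (λ _ _ → refl) xs ⟩
  ∑ xs (λ _ → ∑ xs (λ _ → 1))
    ≡⟨ ∑-const xs _ ⟩
  length xs * ∑ xs (λ _ → 1)
    ≡⟨ cong (length xs *_) (∑-1≡length xs) ⟩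
  length xs * length xs ∎
  where open ≡-Reasoning

indicator : Dec P → ℕ
indicator (yes _) = 1
indicator (no _)  = 0

indicator-yes : (p? : Dec P) → P → indicator p? ≡ 1
indicator-yes (yes _) _ = refl
indicator-yes (no ¬p) p = contradiction p ¬p

indicator-no : (p? : Dec P) → ¬ P → indicator p? ≡ 0
indicator-no (yes p) ¬p = contradiction p ¬p
indicator-no (no _)  _  = refl

indicator-⇔ : P ⇔ Q → (p? : Dec P) (q? : Dec Q) → indicator p? ≡ indicator q?
indicator-⇔ P⇔Q (yes _) (yes _) = refl
indicator-⇔ P⇔Q (no _)  (no _)  = refl
indicator-⇔ P⇔Q (yes p) (no ¬q) = contradiction (Equivalence.to P⇔Q p) ¬q
indicator-⇔ P⇔Q (no ¬p) (yes q) = contradiction (Equivalence.from P⇔Q q) ¬p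

indicator-× : P ⇔ (Q × R) → (p? : Dec P) (q? : Dec Q) (r? : Dec R) → indicator p? ≡ indicator q? * indicator r?
indicator-× P⇔Q×R p? (yes q) (yes r) = indicator-yes p? (Equivalence.from P⇔Q×R (q , r))
indicator-× P⇔Q×R p? (no ¬q) r?      = indicator-no p? (¬q ∘ proj₁ ∘ Equivalence.to P⇔Q×R)
indicator-× P⇔Q×R p? (yes q) (no ¬r) = indicator-no p? (¬r ∘ proj₂ ∘ Equivalence.to P⇔Q×R)

coprime-self : Coprime x x → x ≡ 1
coprime-self cop = cop (∣-refl , ∣-refl)

coprime-∣ : ∀ {a b y z} → Coprime a b → y ∣ a → z ∣ b → Coprime y z
coprime-∣ cop y∣a z∣b (d∣y , d∣z) = cop (∣-trans d∣y y∣a , ∣-trans d∣z z∣b)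

coprime-*ˡ : ∀ {a b c} → Coprime a c → Coprime b c → Coprime (a * b) c
coprime-*ˡ {a} ac bc (d∣ab , d∣c) = bc (coprime-divisor (coprime-∣ (Coprime.sym ac) d∣c ∣-refl) d∣ab , d∣c)

coprime-*ʳ : ∀ {a b c} → Coprime a b → Coprime a c → Coprime a (b * c)
coprime-*ʳ ab ac = Coprime.sym (coprime-*ˡ (Coprime.sym ab) (Coprime.sym ac))

coprime-^ˡ : ∀ {a b} k → Coprime a b → Coprime (a ^ k) b
coprime-^ˡ {b = b} zero    ab = 1-coprimeTo b
coprime-^ˡ         (suc k) ab = coprime-*ˡ ab (coprime-^ˡ k ab)

coprime-*-*⇔ : ∀ {a b y y′ z z′} → Coprime a b → y ∣ a → y′ ∣ a → z ∣ b → z′ ∣ b →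
  Coprime (y * z) (y′ * z′) ⇔ (Coprime y y′ × Coprime z z′)
coprime-*-*⇔ {y = y} {y′} {z} {z′} ab y∣a y′∣a z∣b z′∣b = mk⇔ split join
  where
  split : Coprime (y * z) (y′ * z′) → Coprime y y′ × Coprime z z′
  split cop = coprime-∣ cop (m∣m*n z) (m∣m*n z′) , coprime-∣ cop (n∣m*n y) (n∣m*n y′)
  join : Coprime y y′ × Coprime z z′ → Coprime (y * z) (y′ * z′)
  join (yy′ , zz′) = coprime-*ˡ (coprime-*ʳ yy′ (coprime-∣ ab y∣a z′∣b))
                                (coprime-*ʳ (Coprime.sym (coprime-∣ ab y′∣a z∣b)) zz′)

[coprime] : ℕ → ℕ → ℕ
[coprime] x y = indicator (coprime? x y)

[coprime]-sym : ∀ x y → [coprime] x y ≡ [coprime] y x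
[coprime]-sym x y = indicator-⇔ (mk⇔ Coprime.sym Coprime.sym) (coprime? x y) (coprime? y x)

[coprime]-* : ∀ {a b y y′ z z′} → Coprime a b → y ∣ a → y′ ∣ a → z ∣ b → z′ ∣ b →
  [coprime] (y * z) (y′ * z′) ≡ [coprime] y y′ * [coprime] z z′
[coprime]-* {y = y} {y′} {z} {z′} ab y∣a y′∣a z∣b z′∣b =
  indicator-× (coprime-*-*⇔ ab y∣a y′∣a z∣b z′∣b) (coprime? _ _) (coprime? y y′) (coprime? z z′)

prime∤⇒coprime : Prime p → ¬ p ∣ x → Coprime p x
prime∤⇒coprime p-prime p∤x (d∣p , d∣x) with prime⇒irreducible p-prime d∣p
... | inj₁ d≡1 = d≡1
... | inj₂ refl = contradiction d∣x p∤x

distinct-primes-coprime : ∀ {p q} → Prime p → Prime q → p ≢ q → Coprime p q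
distinct-primes-coprime p-prime q-prime p≢q = prime∤⇒coprime p-prime λ p∣q →
  [ nonTrivial⇒≢1 {{prime⇒nonTrivial p-prime}} , p≢q ]′ (prime⇒irreducible q-prime p∣q)

∣*⇒∃∣×∣ : ∀ {x} a b .{{_ : NonZero a}} → x ∣ a * b → ∃₂ λ y z → y ∣ a × z ∣ b × x ≡ y * z
-- Take y = gcd x a: x divides gcd (b * x) (b * a) = b * y, so x / y divides b.
∣*⇒∃∣×∣ {x} a b x∣ab with gcd[m,n]∣m x a
... | divides q x≡q*g = gcd x a , q , gcd[m,n]∣n x a , q∣b , trans x≡q*g (*-comm q (gcd x a))
  where
  instance
    gcd≢0 : NonZero (gcd x a)
    gcd≢0 = ≢-nonZero (gcd[m,n]≢0 x a (inj₂ (≢-nonZero⁻¹ a)))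
  x∣b*g : x ∣ b * gcd x a
  x∣b*g = subst (x ∣_) (sym (c*gcd[m,n]≡gcd[cm,cn] b x a))
                (gcd-greatest (n∣m*n b) (subst (x ∣_) (*-comm a b) x∣ab))
  q∣b : q ∣ b
  q∣b = *-cancelʳ-∣ (gcd x a) (subst (_∣ b * gcd x a) x≡q*g x∣b*g)

coprime-*-injective : ∀ {a b y y′ z z′} .{{_ : NonZero a}} → Coprime a b →
  y ∣ a → y′ ∣ a → z ∣ b → z′ ∣ b → y * z ≡ y′ * z′ → y ≡ y′ × z ≡ z′
coprime-*-injective {a} {b} {y} {y′} {z} {z′} ab y∣a y′∣a z∣b z′∣b eq = y≡y′ , z≡z′
  where
  y≡y′ : y ≡ y′
  y≡y′ = ∣-antisym
    (coprime-divisor (coprime-∣ ab y∣a z′∣b) (subst (y ∣_) (trans eq (*-comm y′ z′)) (m∣m*n z)))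
    (coprime-divisor (coprime-∣ ab y′∣a z∣b) (subst (y′ ∣_) (trans (sym eq) (*-comm y z)) (m∣m*n z′)))
  instance
    y≢0 : NonZero y
    y≢0 = ≢-nonZero λ { refl → ≢-nonZero⁻¹ a (0∣⇒≡0 y∣a) }
  z≡z′ : z ≡ z′
  z≡z′ = *-cancelˡ-≡ z z′ y (trans eq (cong (_* z′) (sym y≡y′)))

^-monoʳ-∣ : ∀ m {i j} → i ≤ j → m ^ i ∣ m ^ j
^-monoʳ-∣ m {j = j} z≤n       = 1∣ (m ^ j)
^-monoʳ-∣ m         (s≤s i≤j) = *-monoʳ-∣ m (^-monoʳ-∣ m i≤j)

∣p^k⇒≡p^i : Prime p → ∀ k → x ∣ p ^ k → ∃ λ i → i ≤ k × x ≡ p ^ i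
∣p^k⇒≡p^i {p} {x} p-prime zero    x∣1 = 0 , z≤n , ∣1⇒≡1 x∣1
∣p^k⇒≡p^i {p} {x} p-prime (suc k) x∣p^1+k with p ∣? x
... | yes (divides q refl) =
  let q*p∣p^k*p = subst (q * p ∣_) (*-comm p (p ^ k)) x∣p^1+k
      i , i≤k , q≡p^i = ∣p^k⇒≡p^i {x = q} p-prime k (*-cancelʳ-∣ p {{prime⇒nonZero p-prime}} q*p∣p^k*p)
  in suc i , s≤s i≤k , trans (cong (_* p) q≡p^i) (*-comm (p ^ i) p)
... | no p∤x =
  let i , i≤k , x≡p^i = ∣p^k⇒≡p^i p-prime k
                          (coprime-divisor (Coprime.sym (prime∤⇒coprime p-prime p∤x)) x∣p^1+k)
  in i , m≤n⇒m≤1+n i≤k , x≡p^i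

∈-divisors⁻ : x ∈ divisors n → x ∣ n
∈-divisors⁻ {n = n} x∈ = proj₂ (∈-filter⁻ (_∣? n) {xs = applyUpTo suc n} x∈)

∈-divisors⁺ : .{{_ : NonZero n}} → x ∣ n → x ∈ divisors n
∈-divisors⁺ {n} {zero}  0∣n = contradiction (0∣⇒≡0 0∣n) (≢-nonZero⁻¹ n)
∈-divisors⁺ {n} {suc x} x∣n = ∈-filter⁺ (_∣? n) (∈-applyUpTo⁺ suc (∣⇒≤ x∣n)) x∣n

divisors-unique : ∀ n → Unique (divisors n)
divisors-unique n = Unique.filter⁺ (_∣? n) (Unique.applyUpTo⁺₁ suc n λ i<j _ → <⇒≢ (s≤s i<j))

↭-divisors : ∀ {xs} n .{{_ : NonZero n}} → Unique xs → (∀ {x} → x ∈ xs ⇔ x ∣ n) → xs ↭ divisors n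
↭-divisors n xs! ∈xs⇔∣n = ∼bag⇒↭ (unique∧set⇒bag xs! (divisors-unique n)
  (mk⇔ (∈-divisors⁺ ∘ Equivalence.to ∈xs⇔∣n) (Equivalence.from ∈xs⇔∣n ∘ ∈-divisors⁻)))

divisors-* : ∀ a b .{{_ : NonZero a}} .{{_ : NonZero b}} → Coprime a b →
  cartesianProductWith _*_ (divisors a) (divisors b) ↭ divisors (a * b)
divisors-* a b ab = ↭-divisors (a * b) {{m*n≢0 a b}}
  (Unique-cartesianProductWith⁺ _*_
    (λ y∈ y′∈ z∈ z′∈ → coprime-*-injective ab (∈-divisors⁻ y∈) (∈-divisors⁻ y′∈)
                                              (∈-divisors⁻ z∈) (∈-divisors⁻ z′∈))
    (divisors-unique a) (divisors-unique b))
  (mk⇔ sound complete)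
  where
  sound : x ∈ cartesianProductWith _*_ (divisors a) (divisors b) → x ∣ a * b
  sound x∈ with ∈-cartesianProductWith⁻ _*_ (divisors a) (divisors b) x∈
  ... | y , z , y∈ , z∈ , refl = *-pres-∣ (∈-divisors⁻ {n = a} y∈) (∈-divisors⁻ {n = b} z∈)
  complete : x ∣ a * b → x ∈ cartesianProductWith _*_ (divisors a) (divisors b)
  complete x∣ab with ∣*⇒∃∣×∣ a b x∣ab
  ... | y , z , y∣a , z∣b , refl = ∈-cartesianProductWith⁺ _*_ (∈-divisors⁺ y∣a) (∈-divisors⁺ z∣b)

powers : ℕ → ℕ → List ℕ
powers p k = applyUpTo (p ^_) (suc k)

divisors-^ : Prime p → ∀ k → powers p k ↭ divisors (p ^ k)
divisors-^ {p} p-prime k = ↭-divisors (p ^ k) {{m^n≢0 p k {{prime⇒nonZero p-prime}}}}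
  (Unique.applyUpTo⁺₁ (p ^_) (suc k) λ i<j _ →
    <⇒≢ (^-monoʳ-< p (nonTrivial⇒n>1 p {{prime⇒nonTrivial p-prime}}) i<j))
  (mk⇔ sound complete)
  where
  sound : x ∈ powers p k → x ∣ p ^ k
  sound x∈ with ∈-applyUpTo⁻ (p ^_) x∈
  ... | i , s≤s i≤k , refl = ^-monoʳ-∣ p i≤k
  complete : x ∣ p ^ k → x ∈ powers p k
  complete x∣p^k with ∣p^k⇒≡p^i p-prime k x∣p^k
  ... | i , i≤k , refl = ∈-applyUpTo⁺ (p ^_) (s≤s i≤k)

length-divisors-^ : Prime p → ∀ k → length (divisors (p ^ k)) ≡ suc k
length-divisors-^ {p} p-prime k = trans (sym (↭-length (divisors-^ p-prime k))) (length-applyUpTo (p ^_) (suc k))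

module _ {n u v : ℕ} where

  isDist-functional : ∀ {k k′} → IsDist n u v k → IsDist n u v k′ → k ≡ k′
  isDist-functional (walk , shortest) (walk′ , shortest′) = ≤-antisym (shortest _ walk′) (shortest′ _ walk)

  isDist-coprime : v ∣ n → u ≢ v → Coprime u v → IsDist n u v 1
  isDist-coprime v∣n u≢v cop = step v∣n (u≢v , coprime⇒gcd≡1 cop) here , shortest
    where
    shortest : ∀ m → Walk n m u v → 1 ≤ m
    shortest zero    here = contradiction refl u≢v
    shortest (suc m) _    = s≤s z≤n

  isDist-¬coprime : v ∣ n → u ≢ v → ¬ Coprime u v → IsDist n u v 2
  isDist-¬coprime v∣n u≢v ¬cop = walk-via-1 , shortest
    where
    walk-via-1 : Walk n 2 u v
    walk-via-1 =
      step (1∣ n) ((λ { refl → ¬cop (1-coprimeTo v) }) , coprime⇒gcd≡1 (Coprime.sym (1-coprimeTo u)))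
        (step v∣n ((λ { refl → ¬cop (Coprime.sym (1-coprimeTo u)) }) , coprime⇒gcd≡1 (1-coprimeTo v)) here)
    shortest : ∀ m → Walk n m u v → 2 ≤ m
    shortest zero          here                    = contradiction refl u≢v
    shortest (suc zero)    (step _ (_ , g≡1) here) = ⊥-elim (¬cop (gcd≡1⇒coprime g≡1))
    shortest (suc (suc m)) _                       = s≤s (s≤s z≤n)

  hyperWiener-term : ∀ {k} → v ∣ n → u ≢ v → IsDist n u v k → (k + k * k) / 2 + 2 * [coprime] u v ≡ 3
  hyperWiener-term {k} v∣n u≢v dist = by-coprimality (coprime? u v)
    where
    by-coprimality : (cop? : Dec (Coprime u v)) → (k + k * k) / 2 + 2 * indicator cop? ≡ 3
    by-coprimality (yes cop)  rewrite isDist-functional dist (isDist-coprime v∣n u≢v cop)   = refl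
    by-coprimality (no ¬cop) rewrite isDist-functional dist (isDist-¬coprime v∣n u≢v ¬cop) = refl

hyperWiener+coprimePairs : ∀ n (d : ℕ → ℕ → ℕ) →
  (∀ u v → u ∣ n → v ∣ n → u ≢ v → IsDist n u v (d u v)) →
  hyperWiener n d + 2 * ∑ (pairs (divisors n)) (uncurry [coprime]) ≡ 3 * length (pairs (divisors n))
hyperWiener+coprimePairs n d dist = begin
  hyperWiener n d + 2 * ∑ ps (uncurry [coprime])
    ≡⟨ cong (hyperWiener n d +_) (*-distribˡ-∑ 2 ps (uncurry [coprime])) ⟩
  hyperWiener n d + ∑ ps (λ uv → 2 * uncurry [coprime] uv)
    ≡⟨ sym (∑-+ ps _ _) ⟩
  ∑ ps _ -- the summand of hyperWiener is a pattern lambda, so it cannot be restated here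
    ≡⟨ ∑-cong ps (λ { {u , v} uv∈ → term (∈-pairs⁻ (divisors-unique n) uv∈) }) ⟩
  ∑ ps (λ _ → 3)
    ≡⟨ trans (∑-const ps 3) (*-comm (length ps) 3) ⟩
  3 * length ps ∎
  where
  open ≡-Reasoning
  ps = pairs (divisors n)
  term : ∀ {u v} → u ∈ divisors n × v ∈ divisors n × u ≢ v →
         (d u v + d u v * d u v) / 2 + 2 * [coprime] u v ≡ 3
  term {u} {v} (u∈ , v∈ , u≢v) =
    hyperWiener-term (∈-divisors⁻ v∈) u≢v (dist u v (∈-divisors⁻ u∈) (∈-divisors⁻ v∈) u≢v)

coprimePairs : List ℕ → ℕ
coprimePairs xs = ∑ xs λ x → ∑ xs ([coprime] x)

coprimePairs-↭ : ∀ {xs ys} → xs ↭ ys → coprimePairs xs ≡ coprimePairs ys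
coprimePairs-↭ {xs} {ys} xs↭ys =
  trans (∑-↭ (λ x → ∑ xs ([coprime] x)) xs↭ys) (∑-cong ys λ {x} _ → ∑-↭ ([coprime] x) xs↭ys)

coprimePairs-cartesianProduct : ∀ {a b ys zs} → Coprime a b →
  (∀ {y} → y ∈ ys → y ∣ a) → (∀ {z} → z ∈ zs → z ∣ b) →
  coprimePairs (cartesianProductWith _*_ ys zs) ≡ coprimePairs ys * coprimePairs zs
coprimePairs-cartesianProduct {ys = ys} {zs} ab ∣a ∣b = begin
  ∑ yzs (λ x → ∑ yzs ([coprime] x))
    ≡⟨ ∑-cartesianProductWith _*_ ys zs _ ⟩
  ∑ ys (λ y → ∑ zs λ z → ∑ yzs ([coprime] (y * z)))
    ≡⟨ ∑-cong ys (λ y∈ → ∑-cong zs λ z∈ → trans (∑-cartesianProductWith _*_ ys zs _)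
         (∑-cong ys λ y′∈ → ∑-cong zs λ z′∈ → [coprime]-* ab (∣a y∈) (∣a y′∈) (∣b z∈) (∣b z′∈))) ⟩
  ∑ ys (λ y → ∑ zs λ z → ∑ ys λ y′ → ∑ zs λ z′ → [coprime] y y′ * [coprime] z z′)
    ≡⟨ ∑-cong ys (λ _ → ∑-cong zs λ _ → ∑-*-∑ ys zs _ _) ⟩
  ∑ ys (λ y → ∑ zs λ z → ∑ ys ([coprime] y) * ∑ zs ([coprime] z))
    ≡⟨ ∑-*-∑ ys zs _ _ ⟩
  coprimePairs ys * coprimePairs zs ∎
  where
  open ≡-Reasoning
  yzs = cartesianProductWith _*_ ys zs

coprimePairs-1∷ : ∀ qs → (∀ {x y} → x ∈ qs → y ∈ qs → ¬ Coprime x y) →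
  coprimePairs (1 ∷ qs) ≡ 2 * length qs + 1
coprimePairs-1∷ qs ¬coprime = begin
  row 1 + ∑ qs row                   ≡⟨ cong₂ _+_ row-1 (∑-cong qs row-q) ⟩
  suc (length qs) + ∑ qs (λ _ → 1)  ≡⟨ cong (suc (length qs) +_) (∑-1≡length qs) ⟩
  suc (length qs) + length qs        ≡⟨ rearrange (length qs) ⟩
  2 * length qs + 1                  ∎
  where
  open ≡-Reasoning
  row : ℕ → ℕ
  row x = ∑ (1 ∷ qs) ([coprime] x)
  row-1 : row 1 ≡ suc (length qs)
  row-1 = cong₂ _+_ (indicator-yes (coprime? _ _) (1-coprimeTo 1))
                    (trans (∑-cong qs λ {y} _ → indicator-yes (coprime? _ _) (1-coprimeTo y)) (∑-1≡length qs))
  row-q : ∀ {x} → x ∈ qs → row x ≡ 1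
  row-q {x} x∈ = cong₂ _+_ (indicator-yes (coprime? _ _) (Coprime.sym (1-coprimeTo x)))
                           (trans (∑-cong qs λ y∈ → indicator-no (coprime? _ _) (¬coprime x∈ y∈)) (∑-0≡0 qs))
  rearrange : ∀ l → suc l + l ≡ 2 * l + 1
  rearrange = solve-∀

coprimePairs-powers : Prime p → ∀ k → coprimePairs (powers p k) ≡ 2 * k + 1
coprimePairs-powers {p} p-prime k =
  trans (coprimePairs-1∷ qs ¬coprime) (cong (λ l → 2 * l + 1) (length-applyUpTo _ k))
  where
  -- powers p k reduces to 1 ∷ qs
  qs = applyUpTo (λ i → p ^ suc i) k
  p∣ : ∀ {x} → x ∈ qs → p ∣ x
  p∣ x∈ with ∈-applyUpTo⁻ (λ i → p ^ suc i) x∈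
  ... | i , _ , refl = m∣m*n (p ^ i)
  ¬coprime : ∀ {x y} → x ∈ qs → y ∈ qs → ¬ Coprime x y
  ¬coprime x∈ y∈ cop = nonTrivial⇒≢1 {{prime⇒nonTrivial p-prime}} (cop (p∣ x∈ , p∣ y∈))

coprimePairs-divisors-^ : Prime p → ∀ k → coprimePairs (divisors (p ^ k)) ≡ 2 * k + 1
coprimePairs-divisors-^ p-prime k =
  trans (sym (coprimePairs-↭ (divisors-^ p-prime k))) (coprimePairs-powers p-prime k)

∑-[coprime]-diagonal : ∀ {xs} → Unique xs → 1 ∈ xs → ∑ xs (λ x → [coprime] x x) ≡ 1
∑-[coprime]-diagonal {1 ∷ xs} (1∉xs ∷ _) (here refl) =
  cong₂ _+_ (indicator-yes (coprime? _ _) (1-coprimeTo 1))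
            (trans (∑-cong xs λ x∈ → indicator-no (coprime? _ _) (All-lookup 1∉xs x∈ ∘ sym ∘ coprime-self))
                   (∑-0≡0 xs))
∑-[coprime]-diagonal {x ∷ xs} (x∉xs ∷ xs!) (there 1∈xs) =
  cong₂ _+_ (indicator-no (coprime? _ _) (All-lookup x∉xs 1∈xs ∘ coprime-self)) (∑-[coprime]-diagonal xs! 1∈xs)

coprimePairs-divisors : ∀ n .{{_ : NonZero n}} →
  2 * ∑ (pairs (divisors n)) (uncurry [coprime]) + 1 ≡ coprimePairs (divisors n)
coprimePairs-divisors n = trans
  (cong (2 * ∑ (pairs (divisors n)) (uncurry [coprime]) +_)
        (sym (∑-[coprime]-diagonal (divisors-unique n) (∈-divisors⁺ (1∣ n)))))
  (∑-pairs-symmetric [coprime] [coprime]-sym (divisors n))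

Multiplicative : (ℕ → ℕ) → Set
Multiplicative f = ∀ a b .{{_ : NonZero a}} .{{_ : NonZero b}} → Coprime a b → f (a * b) ≡ f a * f b

length∘divisors-multiplicative : Multiplicative (length ∘ divisors)
length∘divisors-multiplicative a b ab =
  trans (sym (↭-length (divisors-* a b ab))) (length-cartesianProductWith _*_ (divisors a) (divisors b))

coprimePairs∘divisors-multiplicative : Multiplicative (coprimePairs ∘ divisors)
coprimePairs∘divisors-multiplicative a b ab =
  trans (sym (coprimePairs-↭ (divisors-* a b ab))) (coprimePairs-cartesianProduct ab ∈-divisors⁻ ∈-divisors⁻)

unfactorise : List (ℕ × ℕ) → ℕ
unfactorise fac = product (map (λ pk → proj₁ pk ^ proj₂ pk) fac)

Primes : List (ℕ × ℕ) → Set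
Primes fac = All (λ pk → Prime (proj₁ pk)) fac

unfactorise-nonZero : ∀ {fac} → Primes fac → NonZero (unfactorise fac)
unfactorise-nonZero []                          = _
unfactorise-nonZero {(p , k) ∷ fac} (p-prime ∷ primes) =
  m*n≢0 (p ^ k) (unfactorise fac) {{m^n≢0 p k {{prime⇒nonZero p-prime}}}} {{unfactorise-nonZero primes}}

coprime-unfactorise : ∀ {p fac} → Prime p → Primes fac → All (p ≢_) (map proj₁ fac) → Coprime p (unfactorise fac)
coprime-unfactorise {p} p-prime [] [] = Coprime.sym (1-coprimeTo p)
coprime-unfactorise {p} {(q , j) ∷ fac} p-prime (q-prime ∷ primes) (p≢q ∷ p∉) =
  coprime-*ʳ (Coprime.sym (coprime-^ˡ j (Coprime.sym (distinct-primes-coprime p-prime q-prime p≢q))))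
             (coprime-unfactorise p-prime primes p∉)

multiplicative-unfactorise : ∀ f → Multiplicative f → f 1 ≡ 1 →
  ∀ g → (∀ {p} → Prime p → ∀ k → f (p ^ k) ≡ g k) →
  ∀ fac → Primes fac → Unique (map proj₁ fac) → f (unfactorise fac) ≡ product (map (g ∘ proj₂) fac)
multiplicative-unfactorise f f-mult f1≡1 g f-pow [] [] [] = f1≡1
multiplicative-unfactorise f f-mult f1≡1 g f-pow ((p , k) ∷ fac) (p-prime ∷ primes) (p∉ ∷ distinct) = begin
  f (p ^ k * unfactorise fac)
    ≡⟨ f-mult (p ^ k) (unfactorise fac) {{m^n≢0 p k {{prime⇒nonZero p-prime}}}} {{unfactorise-nonZero primes}}
              (coprime-^ˡ k (coprime-unfactorise p-prime primes p∉)) ⟩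
  f (p ^ k) * f (unfactorise fac)
    ≡⟨ cong₂ _*_ (f-pow p-prime k) (multiplicative-unfactorise f f-mult f1≡1 g f-pow fac primes distinct) ⟩
  g k * product (map (g ∘ proj₂) fac) ∎
  where open ≡-Reasoning

hyperWiener-arithmetic : ∀ {W C S P D} → W + 2 * C ≡ 3 * P → 2 * C + 1 ≡ S → 2 * P + D ≡ D * D →
  W + S ≡ 3 * D * (D ∸ 1) / 2 + 1
hyperWiener-arithmetic {W} {C} {S} {P} {D} W+2C≡3P 2C+1≡S 2P+D≡D² = begin
  W + S               ≡⟨ cong (W +_) (sym 2C+1≡S) ⟩
  W + (2 * C + 1)     ≡⟨ sym (+-assoc W (2 * C) 1) ⟩
  W + 2 * C + 1       ≡⟨ cong (_+ 1) W+2C≡3P ⟩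
  3 * P + 1           ≡⟨ cong (_+ 1) (sym (m*n/n≡m (3 * P) 2)) ⟩
  3 * P * 2 / 2 + 1   ≡⟨ cong (λ t → t / 2 + 1) (sym 3D[D-1]≡3P*2) ⟩
  3 * D * (D ∸ 1) / 2 + 1 ∎
  where
  open ≡-Reasoning
  D[D-1]≡2P : D * (D ∸ 1) ≡ 2 * P
  D[D-1]≡2P = begin
    D * (D ∸ 1)       ≡⟨ *-distribˡ-∸ D D 1 ⟩
    D * D ∸ D * 1     ≡⟨ cong₂ _∸_ (sym 2P+D≡D²) (*-identityʳ D) ⟩
    2 * P + D ∸ D     ≡⟨ m+n∸n≡m (2 * P) D ⟩
    2 * P             ∎
  3D[D-1]≡3P*2 : 3 * D * (D ∸ 1) ≡ 3 * P * 2
  3D[D-1]≡3P*2 = begin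
    3 * D * (D ∸ 1)   ≡⟨ *-assoc 3 D (D ∸ 1) ⟩
    3 * (D * (D ∸ 1)) ≡⟨ cong (3 *_) D[D-1]≡2P ⟩
    3 * (2 * P)       ≡⟨ reorder P ⟩
    3 * P * 2         ∎
    where
    reorder : ∀ P → 3 * (2 * P) ≡ 3 * P * 2
    reorder = solve-∀

theorem3p3 : (n : ℕ) (fac : List (ℕ × ℕ)) →
    All (λ pk → Prime (proj₁ pk)) fac →
    Unique (map proj₁ fac) →
    All (λ pk → 1 ≤ proj₂ pk) fac →
    n ≡ product (map (λ pk → proj₁ pk ^ proj₂ pk) fac) →
    (d : ℕ → ℕ → ℕ) →
    (∀ u v → u ∣ n → v ∣ n → u ≢ v → IsDist n u v (d u v)) →
    hyperWiener n d + product (map (λ pk → 2 * proj₂ pk + 1) fac)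
      ≡ (3 * product (map (λ pk → suc (proj₂ pk)) fac)
           * (product (map (λ pk → suc (proj₂ pk)) fac) ∸ 1)) / 2 + 1
theorem3p3 n fac primes distinct _ refl d dist =
  hyperWiener-arithmetic {C = coprimeEdges} {P = length (pairs (divisors n))} {D = D}
    (hyperWiener+coprimePairs n d dist) coprimeCount vertexCount
  where
  instance
    n≢0 : NonZero n
    n≢0 = unfactorise-nonZero primes
  coprimeEdges = ∑ (pairs (divisors n)) (uncurry [coprime])
  coprimeCount : 2 * coprimeEdges + 1 ≡ product (map (λ pk → 2 * proj₂ pk + 1) fac)
  coprimeCount = trans (coprimePairs-divisors n)
    (multiplicative-unfactorise (coprimePairs ∘ divisors) coprimePairs∘divisors-multiplicative refl
                                (λ k → 2 * k + 1) coprimePairs-divisors-^ fac primes distinct)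
  D = product (map (λ pk → suc (proj₂ pk)) fac)
  vertexCount : 2 * length (pairs (divisors n)) + D ≡ D * D
  vertexCount = subst (λ D → 2 * length (pairs (divisors n)) + D ≡ D * D)
    (multiplicative-unfactorise (length ∘ divisors) length∘divisors-multiplicative refl
                                suc length-divisors-^ fac primes distinct)
    (length-pairs (divisors n))
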